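{- Let $B\subseteq\{l,r\}^\star$. Then $B$ has an infinite antichain if and only if there is an infinite sequence of nodes $\varepsilon=u_0\sqsubseteq u_1\sqsubseteq u_2\sqsubseteq\cdots$ forming an infinite branch (each $u_{j+1}$ is $u_j$ followed by one letter) such that there exist infinitely many integers $n_i$ for which $u_{n_i}.a\sqsubseteq v_i$ for some $a\in\{l,r\}$ and some $v_i\in B$, and $u_{n_i+1}=u_{n_i}.b$ with $b\in\{l,r\}$, $b\neq a$.
   Context: $\sqsubseteq$ is the prefix order on $\{l,r\}^\star$, and $u.a$ denotes concatenation. An antichain is a set of pairwise $\sqsubseteq$-incomparable words. -}

module Defs where

open import Data.Nat using (ℕ; zero; suc; _≤_)
open import Data.List using (List; []; _∷_; _++_; _∷ʳ_)
open import Data.Product using (Σ; ∃; ∃-syntax; _×_; _,_)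
open import Relation.Binary.PropositionalEquality using (_≡_; _≢_)
open import Relation.Nullary using (¬_)

data Letter : Set where
  l r : Letter

Word : Set
Word = List Letter

_⊑_ : Word → Word → Set
u ⊑ v = ∃[ w ] (u ++ w ≡ v)

_·_ : Word → Letter → Word
u · a = u ∷ʳ a

-- B has an infinite antichain: an injectively-indexed sequence of elements
-- of B which are pairwise ⊑-incomparable (distinct indices give
-- incomparable, hence distinct, words).
HasInfiniteAntichain : (Word → Set) → Set
HasInfiniteAntichain B =
  Σ (ℕ → Word) λ f →
    (∀ i → B (f i)) × (∀ i j → i ≢ j → ¬ (f i ⊑ f j))

IsBranch : (ℕ → Word) → Set
IsBranch u = (u 0 ≡ []) × (∀ j → ∃[ c ] (u (suc j) ≡ u j · c))

InfinitelyMany : (ℕ → Set) → Set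
InfinitelyMany P = ∀ N → ∃[ n ] (N ≤ n × P n)

BranchOff : (Word → Set) → (ℕ → Word) → ℕ → Set
BranchOff B u n =
  ∃[ a ] ∃[ v ] (B v × (u n · a) ⊑ v ×
    ∃[ b ] (b ≢ a × u (suc n) ≡ u n · b))

module Submission where

-- (⇐) If the branch u leaves B infinitely often, pick branch-off points
-- n₀ < n₁ < ⋯ with witnesses vₖ ∈ B, u(nₖ)·aₖ ⊑ vₖ and u(nₖ+1) = u(nₖ)·bₖ,
-- bₖ ≠ aₖ.  For i < j the word vⱼ extends u(nᵢ+1) = u(nᵢ)·bᵢ, so vᵢ and vⱼ
-- fork at u(nᵢ) and are incomparable: (vₖ) is an infinite antichain.
--
-- (⇒) (classical, König-style) Given an antichain f, call a word heavy if
-- infinitely many f i extend it.  A heavy word has a heavy child, since at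
-- most one f i equals it and infinitely many proper extensions split into
-- those through x·l and those through x·r.  Following heavy children from ε
-- gives a branch.  If it branched off towards B only finitely often, every
-- f i extending a late enough node would lie on the branch; the heavy node
-- there yields two distinct such f i, comparable on the branch — impossible.

open import Defs
open import Level using (0ℓ)
open import Axiom.ExcludedMiddle using (ExcludedMiddle)
open import Axiom.DoubleNegationElimination using (em⇒dne)
open import Data.Nat using (ℕ; zero; suc; _≤_; _<_; _≤′_; ≤′-refl; ≤′-step; _⊔_)
open import Data.Nat.Properties
  using (≤-refl; ≤-trans; <-trans; <⇒≤; <⇒≢; n≤1+n; <-cmp; ≤-total; ≤⇒≤′; m≤m⊔n; m≤n⊔m)
open import Data.List using ([]; _∷_; _++_; [_])
open import Data.List.Properties using (++-assoc; ++-identityʳ; ++-cancelˡ; ∷-injectiveˡ)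
open import Data.Product using (Σ; ∃; ∃-syntax; _×_; _,_; proj₁; proj₂)
import Data.Product as Product
open import Data.Sum using (_⊎_; inj₁; inj₂)
open import Data.Empty using (⊥; ⊥-elim)
open import Function.Bundles using (_⇔_; mk⇔)
open import Relation.Nullary using (¬_; Dec; yes; no)
open import Relation.Binary.Definitions using (tri<; tri≈; tri>)
open import Relation.Binary.PropositionalEquality
  using (_≡_; _≢_; refl; sym; trans; cong; subst; subst₂; ≢-sym; module ≡-Reasoning)

_≟ᴸ_ : (a b : Letter) → Dec (a ≡ b)
l ≟ᴸ l = yes refl
l ≟ᴸ r = no λ ()
r ≟ᴸ l = no λ ()
r ≟ᴸ r = yes refl

some-letter : {P : Letter → Set} → ∃ P → P l ⊎ P r
some-letter (l , p) = inj₁ p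
some-letter (r , p) = inj₂ p

·-++ : ∀ (u : Word) a w → (u · a) ++ w ≡ u ++ a ∷ w
·-++ u a w = ++-assoc u [ a ] w

⊑-refl : ∀ {u} → u ⊑ u
⊑-refl {u} = [] , ++-identityʳ u

⊑-trans : ∀ {u v w} → u ⊑ v → v ⊑ w → u ⊑ w
⊑-trans {u} (x , refl) (y , refl) = x ++ y , sym (++-assoc u x y)

⊑-snoc : ∀ {u} a → u ⊑ (u · a)
⊑-snoc a = [ a ] , refl

fork-incomparable : ∀ {u a b x y} → a ≢ b → (u · a) ⊑ x → (u · b) ⊑ y → ¬ (x ⊑ y)
fork-incomparable {u} {a} {b} {x} {y} a≢b ua⊑x (w₂ , e₂) x⊑y
  with ⊑-trans ua⊑x x⊑y
... | w₁ , e₁ = a≢b (∷-injectiveˡ (++-cancelˡ u (a ∷ w₁) (b ∷ w₂) same-word))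
  where
  open ≡-Reasoning
  same-word : u ++ a ∷ w₁ ≡ u ++ b ∷ w₂
  same-word = begin
    u ++ a ∷ w₁   ≡⟨ sym (·-++ u a w₁) ⟩
    (u · a) ++ w₁ ≡⟨ e₁ ⟩
    y             ≡⟨ sym e₂ ⟩
    (u · b) ++ w₂ ≡⟨ ·-++ u b w₂ ⟩
    u ++ b ∷ w₂   ∎

module _ {u : ℕ → Word} (branch : IsBranch u) where

  branch-step : ∀ n → u n ⊑ u (suc n)
  branch-step n with proj₂ branch n
  ... | c , next = [ c ] , sym next

  branch-monotone : ∀ {m n} → m ≤ n → u m ⊑ u n
  branch-monotone m≤n = along (≤⇒≤′ m≤n)
    where
    along : ∀ {m n} → m ≤′ n → u m ⊑ u n
    along ≤′-refl = ⊑-refl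
    along (≤′-step m≤′n) = ⊑-trans (along m≤′n) (branch-step _)

  branch-comparable : ∀ m n → u m ⊑ u n ⊎ u n ⊑ u m
  branch-comparable m n with ≤-total m n
  ... | inj₁ m≤n = inj₁ (branch-monotone m≤n)
  ... | inj₂ n≤m = inj₂ (branch-monotone n≤m)

module _ {B : Word → Set} {u : ℕ → Word} where

  branch-witness : ∀ {n} → BranchOff B u n → Word
  branch-witness (_ , v , _) = v

  branch-witness-∈ : ∀ {n} (p : BranchOff B u n) → B (branch-witness p)
  branch-witness-∈ (_ , _ , v∈B , _) = v∈B

  -- Witnesses of two branch-off points n < m are incomparable: the second
  -- one passes through u (n+1), the child of u n the first one avoids.
  branch-offs-incomparable :
    ∀ {n m} → IsBranch u → n < m → (p : BranchOff B u n) (q : BranchOff B u m) →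
    ¬ (branch-witness p ⊑ branch-witness q) × ¬ (branch-witness q ⊑ branch-witness p)
  branch-offs-incomparable {n} {m} branch n<m
    (a , v , _ , ua⊑v , b , b≢a , next) (a′ , v′ , _ , ua′⊑v′ , _) =
    fork-incomparable (≢-sym b≢a) ua⊑v ub⊑v′ , fork-incomparable b≢a ub⊑v′ ua⊑v
    where
    ub⊑v′ : (u n · b) ⊑ v′
    ub⊑v′ = ⊑-trans (subst (_⊑ u m) next (branch-monotone branch n<m))
                    (⊑-trans (⊑-snoc a′) ua′⊑v′)

settles-on-branch :
  ∀ {B u N v} → IsBranch u → (∀ n → N ≤ n → ¬ BranchOff B u n) → B v →
  ∀ m → N ≤ m → u m ⊑ v → ∃[ m′ ] (v ≡ u m′)
settles-on-branch {B} {u} {N} {v} branch quiet v∈B m N≤m (w , e) = follow m N≤m w e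
  where
  follow : ∀ m → N ≤ m → ∀ w → u m ++ w ≡ v → ∃[ m′ ] (v ≡ u m′)
  follow m _ [] e = m , trans (sym e) (++-identityʳ (u m))
  follow m N≤m (c ∷ w) e with proj₂ branch m
  ... | b , next with c ≟ᴸ b
  ... | yes refl = follow (suc m) (≤-trans N≤m (n≤1+n m)) w descend
    where
    open ≡-Reasoning
    descend : u (suc m) ++ w ≡ v
    descend = begin
      u (suc m) ++ w ≡⟨ cong (_++ w) next ⟩
      (u m · c) ++ w ≡⟨ ·-++ (u m) c w ⟩
      u m ++ c ∷ w   ≡⟨ e ⟩
      v              ∎
  ... | no c≢b =
    ⊥-elim (quiet m N≤m (c , v , v∈B , (w , trans (·-++ (u m) c w) e) , b , ≢-sym c≢b , next))

module _ {P : ℕ → Set} (infinite : InfinitelyMany P) where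

  select : ℕ → ℕ
  select zero = proj₁ (infinite 0)
  select (suc k) = proj₁ (infinite (suc (select k)))

  select-step : ∀ k → select k < select (suc k)
  select-step k = proj₁ (proj₂ (infinite (suc (select k))))

  select-∈ : ∀ k → P (select k)
  select-∈ zero = proj₂ (proj₂ (infinite 0))
  select-∈ (suc k) = proj₂ (proj₂ (infinite (suc (select k))))

  select-increasing : ∀ {i j} → i < j → select i < select j
  select-increasing i<j = along (≤⇒≤′ i<j)
    where
    along : ∀ {i j} → suc i ≤′ j → select i < select j
    along {i} ≤′-refl = select-step i
    along {j = suc j} (≤′-step i<′j) = <-trans (along i<′j) (select-step j)

infinitely-many-map : ∀ {P Q : ℕ → Set} → (∀ {n} → P n → Q n) →
                      InfinitelyMany P → InfinitelyMany Q
infinitely-many-map P⇒Q infinite N = Product.map₂ (Product.map₂ P⇒Q) (infinite N)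

eventually-not : ExcludedMiddle 0ℓ → ∀ {P : ℕ → Set} → ¬ InfinitelyMany P →
                 ∃[ N ] (∀ n → N ≤ n → ¬ P n)
eventually-not em finite =
  dne λ never → finite λ N → dne λ ¬beyond → never (N , λ n N≤n Pn → ¬beyond (n , N≤n , Pn))
  where dne = em⇒dne em

infinitely-many-⊎ : ExcludedMiddle 0ℓ → ∀ {P Q : ℕ → Set} →
                    InfinitelyMany (λ n → P n ⊎ Q n) → InfinitelyMany P ⊎ InfinitelyMany Q
infinitely-many-⊎ em {P} {Q} infinite with em {InfinitelyMany P}
... | yes infinite-P = inj₁ infinite-P
... | no finite-P = inj₂ (only-Q (eventually-not em finite-P))
  where
  only-Q : ∃[ N ] (∀ n → N ≤ n → ¬ P n) → InfinitelyMany Q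
  only-Q (N , ¬P) M with infinite (N ⊔ M)
  ... | n , le , inj₁ Pn = ⊥-elim (¬P n (≤-trans (m≤m⊔n N M) le) Pn)
  ... | n , le , inj₂ Qn = n , ≤-trans (m≤n⊔m N M) le , Qn

pairwise-from-ordered : ∀ {A : Set} (R : A → A → Set) (f : ℕ → A) →
  (∀ {i j} → i < j → ¬ R (f i) (f j) × ¬ R (f j) (f i)) →
  ∀ i j → i ≢ j → ¬ R (f i) (f j)
pairwise-from-ordered R f ordered i j i≢j with <-cmp i j
... | tri< i<j _ _ = proj₁ (ordered i<j)
... | tri≈ _ i≡j _ = ⊥-elim (i≢j i≡j)
... | tri> _ _ j<i = proj₂ (ordered j<i)

branch-offs-antichain : ∀ {B u} → IsBranch u → InfinitelyMany (BranchOff B u) →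
                        HasInfiniteAntichain B
branch-offs-antichain {B} {u} branch infinite =
  witness , (λ k → branch-witness-∈ {B} {u} (select-∈ infinite k)) ,
  pairwise-from-ordered _⊑_ witness λ {i} {j} i<j →
    branch-offs-incomparable branch (select-increasing infinite i<j)
      (select-∈ infinite i) (select-∈ infinite j)
  where
  witness : ℕ → Word
  witness k = branch-witness {B} {u} (select-∈ infinite k)

module HeavyBranch (em : ExcludedMiddle 0ℓ) (f : ℕ → Word)
                   (antichain : ∀ i j → i ≢ j → ¬ (f i ⊑ f j)) where

  Heavy : Word → Set
  Heavy x = InfinitelyMany (λ i → x ⊑ f i)

  heavy-two : ∀ {x} → Heavy x → ∃[ i ] ∃[ j ] (i ≢ j × x ⊑ f i × x ⊑ f j)
  heavy-two heavy with heavy 0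
  ... | i , _ , x⊑fi with heavy (suc i)
  ... | j , i<j , x⊑fj = i , j , <⇒≢ i<j , x⊑fi , x⊑fj

  -- At most one term equals x, so infinitely many extend it properly.
  heavy-proper : ∀ {x} → Heavy x → InfinitelyMany (λ i → ∃[ c ] ((x · c) ⊑ f i))
  heavy-proper {x} heavy N with heavy N
  ... | i , N≤i , x⊑fi with heavy (suc i)
  ... | j , i<j , ([] , e) =
    ⊥-elim (antichain j i (≢-sym (<⇒≢ i<j)) (subst (_⊑ f i) (trans (sym (++-identityʳ x)) e) x⊑fi))
  ... | j , i<j , (c ∷ w , e) = j , ≤-trans N≤i (<⇒≤ i<j) , c , w , trans (·-++ x c w) e

  -- König's step: the proper extensions go through x·l or x·r, and
  -- classically one of the two children receives infinitely many.
  heavy-child : ∀ {x} → Heavy x → ∃[ c ] Heavy (x · c)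
  heavy-child heavy
    with infinitely-many-⊎ em (infinitely-many-map some-letter (heavy-proper heavy))
  ... | inj₁ heavy-l = l , heavy-l
  ... | inj₂ heavy-r = r , heavy-r

  heavy-node : ℕ → Σ Word Heavy
  heavy-node zero = [] , λ N → N , ≤-refl , f N , refl
  heavy-node (suc j) = descend (heavy-node j)
    where
    descend : Σ Word Heavy → Σ Word Heavy
    descend (x , heavy) = x · proj₁ (heavy-child heavy) , proj₂ (heavy-child heavy)

  spine : ℕ → Word
  spine j = proj₁ (heavy-node j)

  spine-branch : IsBranch spine
  spine-branch = refl , λ j → proj₁ (heavy-child (proj₂ (heavy-node j))) , refl

  at-most-one-on-branch : ∀ {u} → IsBranch u → ∀ {i j} → i ≢ j →
                          ∃[ m ] (f i ≡ u m) → ∃[ n ] (f j ≡ u n) → ⊥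
  at-most-one-on-branch branch {i} {j} i≢j (m , fi≡um) (n , fj≡un)
    with branch-comparable branch m n
  ... | inj₁ um⊑un = antichain i j i≢j (subst₂ _⊑_ (sym fi≡um) (sym fj≡un) um⊑un)
  ... | inj₂ un⊑um = antichain j i (≢-sym i≢j) (subst₂ _⊑_ (sym fj≡un) (sym fi≡um) un⊑um)

  -- The heavy branch leaves {f i} infinitely often: otherwise two distinct
  -- terms extending a late heavy node would both settle on the branch.
  spine-branches-off : ∀ (B : Word → Set) → (∀ i → B (f i)) → InfinitelyMany (BranchOff B spine)
  spine-branches-off B f∈B = em⇒dne em λ finite →
    let (N , quiet) = eventually-not em finite
        (i , j , i≢j , uN⊑fi , uN⊑fj) = heavy-two (proj₂ (heavy-node N))
    in at-most-one-on-branch spine-branch i≢j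
         (settles-on-branch spine-branch quiet (f∈B i) N ≤-refl uN⊑fi)
         (settles-on-branch spine-branch quiet (f∈B j) N ≤-refl uN⊑fj)

lemma3p1 : ExcludedMiddle 0ℓ → (B : Word → Set) →
    HasInfiniteAntichain B ⇔ (∃[ u ] (IsBranch u × InfinitelyMany (BranchOff B u)))
lemma3p1 em B = mk⇔ to from
  where
  to : HasInfiniteAntichain B → ∃[ u ] (IsBranch u × InfinitelyMany (BranchOff B u))
  to (f , f∈B , antichain) = spine , spine-branch , spine-branches-off B f∈B
    where open HeavyBranch em f antichain

  from : ∃[ u ] (IsBranch u × InfinitelyMany (BranchOff B u)) → HasInfiniteAntichain B
  from (u , branch , infinite) = branch-offs-antichain branch infinite
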